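{- Let $(P,\le)$ be a poset, $b\in P$, $\Theta$ a congruence on $(P,\le)$ and $(a,c)\in\Theta$. Then: (i) if $[b]\Theta\cap U(c)\ne\emptyset$ then $\operatorname{Max}L(a,b)\cap[c]\Theta\ne\emptyset$; (ii) if $[b]\Theta\cap L(c)\ne\emptyset$ then $\operatorname{Min}U(a,b)\cap[c]\Theta\ne\emptyset$.
   Context: For a poset $(P,\le)$ and $x,y\in P$ let $L(x)=\{z\mid z\le x\}$, $U(x)=\{z\mid x\le z\}$, $L(x,y)=\{z\in P\mid z\le x,\ z\le y\}$ and $U(x,y)=\{z\in P\mid x\le z,\ y\le z\}$; for $A\subseteq P$, $\operatorname{Max}A$ and $\operatorname{Min}A$ denote the sets of maximal and minimal elements of $A$. A binary relation $R$ on $P$ is compatible with a map $Q\colon P^2\to 2^P$ if whenever $(a_1,b_1),(a_2,b_2)\in R$ there exist $a\in Q(a_1,a_2)$ and $b\in Q(b_1,b_2)$ with $(a,b)\in R$. A congruence on $(P,\le)$ is an equivalence relation on $P$ compatible with both $(x,y)\mapsto\operatorname{Max}L(x,y)$ and $(x,y)\mapsto\operatorname{Min}U(x,y)$. $[x]\Theta$ denotes the class of $x$. -}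

module Defs where

open import Level using (Level; _⊔_; suc)
open import Data.Product using (_×_; Σ; ∃; _,_)
open import Relation.Binary.Core using (Rel)
open import Relation.Binary.Structures using (IsPartialOrder; IsEquivalence)
open import Relation.Binary.PropositionalEquality using (_≡_)
open import Relation.Unary using (Pred; _∈_; _∩_; Satisfiable)

record PosetP (c ℓ : Level) : Set (Level.suc (c ⊔ ℓ)) where
  field
    Carrier : Set c
    _≤_ : Rel Carrier ℓ
    isPartialOrder : IsPartialOrder _≡_ _≤_

module PosetNotions {c ℓ : Level} (P : PosetP c ℓ) where
  open PosetP P

  L₁ : Carrier → Pred Carrier ℓ
  L₁ x z = z ≤ x

  U₁ : Carrier → Pred Carrier ℓ
  U₁ x z = x ≤ z

  L : Carrier → Carrier → Pred Carrier ℓ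
  L x y z = (z ≤ x) × (z ≤ y)

  U : Carrier → Carrier → Pred Carrier ℓ
  U x y z = (x ≤ z) × (y ≤ z)

  Max : ∀ {r} → Pred Carrier r → Pred Carrier (c ⊔ ℓ ⊔ r)
  Max A x = (x ∈ A) × (∀ y → y ∈ A → x ≤ y → y ≡ x)

  Min : ∀ {r} → Pred Carrier r → Pred Carrier (c ⊔ ℓ ⊔ r)
  Min A x = (x ∈ A) × (∀ y → y ∈ A → y ≤ x → y ≡ x)

  Compatible : ∀ {r q} → Rel Carrier r → (Carrier → Carrier → Pred Carrier q) → Set (c ⊔ r ⊔ q)
  Compatible R Q = ∀ {a₁ b₁ a₂ b₂} → R a₁ b₁ → R a₂ b₂ →
    Σ Carrier λ a → Σ Carrier λ b → (a ∈ Q a₁ a₂) × (b ∈ Q b₁ b₂) × R a b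

  record IsCongruence {r} (Θ : Rel Carrier r) : Set (c ⊔ ℓ ⊔ r) where
    field
      isEquivalence : IsEquivalence Θ
      compat-Max : Compatible Θ (λ x y → Max (L x y))
      compat-Min : Compatible Θ (λ x y → Min (U x y))

  [_]_ : ∀ {r} → Carrier → Rel Carrier r → Pred Carrier r
  ([ x ] Θ) z = Θ x z

{-# OPTIONS --safe #-}

-- Let d ∈ [b]Θ with c ≤ d (resp. d ≤ c). Compatibility of Θ with Max L applied to
-- (a,c), (b,d) yields x ∈ Max L(a,b) and y ∈ Max L(c,d) with x Θ y; as c ≤ d, c is
-- the greatest element of L(c,d), so y = c. Part (ii) is part (i) in the dual poset,
-- where L, U and Max, Min trade places and congruences stay congruences.
module Submission where

open import Defs
open import Level using (Level)
open import Data.Product using (_×_; _,_)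
open import Function using (flip)
open import Relation.Binary.PropositionalEquality using (_≡_; sym; subst)
open import Relation.Binary.Structures using (IsPartialOrder; IsEquivalence)
open import Relation.Binary.Core using (Rel)
import Relation.Binary.Construct.Flip.EqAndOrd as Flip
open import Relation.Unary using (_∈_; _∩_; Satisfiable)
open PosetP using (Carrier)
open PosetNotions

private
  variable
    c ℓ r : Level

dual : PosetP c ℓ → PosetP c ℓ
dual P = record
  { Carrier        = Carrier P
  ; _≤_            = flip (PosetP._≤_ P)
  ; isPartialOrder = Flip.isPartialOrder (PosetP.isPartialOrder P)
  }

IsCongruence-dual : (P : PosetP c ℓ) {Θ : Rel (Carrier P) r} →
  IsCongruence P Θ → IsCongruence (dual P) Θ
IsCongruence-dual P cong = record
  { isEquivalence = isEquivalence
  ; compat-Max    = compat-Min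
  ; compat-Min    = compat-Max
  } where open IsCongruence cong

module _ (P : PosetP c ℓ) where
  open PosetP P using (_≤_; isPartialOrder)
  open IsPartialOrder isPartialOrder using (refl)

  Max-L-≤⇒≡ˡ : ∀ {x y z} → x ≤ y → z ∈ Max P (L P x y) → z ≡ x
  Max-L-≤⇒≡ˡ x≤y ((z≤x , _) , maximal) = sym (maximal _ (refl , x≤y) z≤x)

  Max-L-∩-class : {Θ : Rel (Carrier P) r} → IsCongruence P Θ →
    ∀ {a b c d} → Θ a c → Θ b d → c ≤ d →
    Satisfiable (Max P (L P a b) ∩ ([_]_ P c Θ))
  Max-L-∩-class {Θ = Θ} cong θac θbd c≤d
    with x , y , x∈MaxLab , y∈MaxLcd , θxy ← IsCongruence.compat-Max cong θac θbd
    = x , x∈MaxLab , IsEquivalence.sym (IsCongruence.isEquivalence cong)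
                       (subst (Θ x) (Max-L-≤⇒≡ˡ c≤d y∈MaxLcd) θxy)

lemma3p7 : ∀ {c ℓ r} (P : PosetP c ℓ) (b : Carrier P) (Θ : Rel (Carrier P) r) →
    IsCongruence P Θ → (a c : Carrier P) → Θ a c →
    (Satisfiable ((([_]_ P b Θ) ∩ U₁ P c)) → Satisfiable (Max P (L P a b) ∩ ([_]_ P c Θ)))
    × (Satisfiable ((([_]_ P b Θ) ∩ L₁ P c)) → Satisfiable (Min P (U P a b) ∩ ([_]_ P c Θ)))
lemma3p7 P b Θ cong a c θac =
    (λ (d , θbd , c≤d) → Max-L-∩-class P cong θac θbd c≤d)
  , (λ (d , θbd , d≤c) → Max-L-∩-class (dual P) (IsCongruence-dual P cong) θac θbd d≤c)
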